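{- Let $q$ be a prime power, $\nu\geq1$, and let $\sigma$ be an automorphism of the graph $Spi(2\nu,q)$. Then $\sigma(\mathcal{M}(1,0;2\nu))=\mathcal{M}(1,0;2\nu)$, where $\mathcal{M}(1,0;2\nu)$ is the set of all $1$-dimensional subspaces of $\mathbb{F}_q^{(2\nu)}$.
   Context: $\mathbb{F}_q^{(2\nu)}$ is the space of row vectors of length $2\nu$ over $\mathbb{F}_q$ and $K_{2\nu}=\begin{pmatrix}0 & I^{(\nu)}\\ -I^{(\nu)} & 0\end{pmatrix}$. A subspace $P$ of dimension $m$ is identified with any $m\times 2\nu$ matrix whose rows form a basis of $P$; $P$ is of type $(m,s)$ if $PK_{2\nu}{}^tP$ has rank $2s$, and $\mathcal{M}(m,s;2\nu)$ denotes the set of subspaces of type $(m,s)$ (so $\mathcal{M}(1,0;2\nu)$ is the set of all $1$-dimensional subspaces). The graph $Spi(2\nu,q)$ has as vertex set all subspaces of $\mathbb{F}_q^{(2\nu)}$ other than $0$ and $\mathbb{F}_q^{(2\nu)}$, with $A,B$ (not necessarily distinct) adjacent iff $AK_{2\nu}{}^tB=0$. An automorphism is a bijection of the vertex set such that $A,B$ are adjacent iff their images are adjacent. -}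

module Defs where

open import Level using (0ℓ)
open import Data.Nat using (ℕ; zero; suc; _^_; _≤_)
open import Data.Nat.Primality using (Prime)
open import Data.Fin using (Fin; zero; suc; _↑ˡ_; _↑ʳ_)
open import Data.Product using (Σ; ∃; _×_; _,_; proj₁)
open import Function.Bundles using (_↔_; _⇔_)
open import Relation.Binary.PropositionalEquality using (_≡_; _≢_)
open import Relation.Nullary using (¬_)
open import Algebra.Structures using (IsCommutativeRing)

IsPrimePower : ℕ → Set
IsPrimePower q = Σ ℕ λ p → Σ ℕ λ k → Prime p × 1 ≤ k × q ≡ p ^ k

record FiniteField (q : ℕ) : Set₁ where
  field
    Carrier : Set
    _+_ _*_ : Carrier → Carrier → Carrier
    -_ : Carrier → Carrier
    0# 1# : Carrier
    isCommutativeRing : IsCommutativeRing _≡_ _+_ _*_ -_ 0# 1#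
    0≢1 : 0# ≢ 1#
    inverse : ∀ x → x ≢ 0# → Σ Carrier λ y → x * y ≡ 1#
    enumeration : Fin q ↔ Carrier

module Symplectic {q : ℕ} (𝔽 : FiniteField q) (ν : ℕ) where
  open FiniteField 𝔽

  Vec : Set
  Vec = Fin (ν Data.Nat.+ ν) → Carrier

  Σ[<_] : (n : ℕ) → (Fin n → Carrier) → Carrier
  Σ[< zero ] f = 0#
  Σ[< suc n ] f = f zero + Σ[< n ] (λ i → f (suc i))

  -- x K_{2ν} ᵗy  with K = [[0, I],[-I, 0]]
  ω : Vec → Vec → Carrier
  ω x y = Σ[< ν ] (λ i → (x (i ↑ˡ ν) * y (ν ↑ʳ i)) + (- (x (ν ↑ʳ i) * y (i ↑ˡ ν))))

  _≐_ : Vec → Vec → Set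
  x ≐ y = ∀ i → x i ≡ y i

  NonZeroVec : Vec → Set
  NonZeroVec v = Σ (Fin (ν Data.Nat.+ ν)) λ i → v i ≢ 0#

  record Subspace : Set₁ where
    field
      mem : Vec → Set
      mem-resp : ∀ {x y} → x ≐ y → mem x → mem y
      zero∈ : mem (λ _ → 0#)
      +-closed : ∀ {x y} → mem x → mem y → mem (λ i → x i + y i)
      *-closed : ∀ c {x} → mem x → mem (λ i → c * x i)

  record Vertex : Set₁ where
    field
      sub : Subspace
      nonzero : Σ Vec λ v → Subspace.mem sub v × NonZeroVec v
      proper  : Σ Vec λ v → ¬ Subspace.mem sub v
    open Subspace sub public

  open Vertex

  _≈_ : Vertex → Vertex → Set
  A ≈ B = ∀ x → (mem A x → mem B x) × (mem B x → mem A x)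

  -- A K ᵗB = 0
  Adjacent : Vertex → Vertex → Set
  Adjacent A B = ∀ x y → mem A x → mem B y → ω x y ≡ 0#

  -- membership in 𝓜(1,0;2ν): A is 1-dimensional (rank condition is automatic)
  InM10 : Vertex → Set
  InM10 A = Σ Vec λ v → NonZeroVec v ×
              (∀ x → mem A x ⇔ (Σ Carrier λ c → x ≐ (λ i → c * v i)))

  record Automorphism : Set₁ where
    field
      σ : Vertex → Vertex
      σ-cong : ∀ {A B} → A ≈ B → σ A ≈ σ B
      σ-injective : ∀ {A B} → σ A ≈ σ B → A ≈ B
      σ-surjective : ∀ B → Σ Vertex λ A → σ A ≈ B
      σ-adj : ∀ A B → Adjacent A B ⇔ Adjacent (σ A) (σ B)

{-# OPTIONS --safe #-}
module Submission where

-- Adjacency of A and C says that C lies in the symplectic complement of A, so the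
-- neighbourhood of a vertex can only shrink as the vertex grows. A line ⟨v⟩ is
-- recovered from its neighbourhood, since (v⊥)⊥ = ⟨v⟩ by nondegeneracy of ω, and
-- every vertex contains a line. Hence the lines are exactly the vertices whose
-- neighbourhood is maximal under inclusion, a purely graph-theoretic property that
-- every automorphism preserves and reflects.

open import Defs
open import Data.Nat using (ℕ; zero; suc; _≤_)
open import Data.Fin using (Fin; zero; suc; _↑ˡ_; _↑ʳ_; splitAt)
open import Data.Fin.Properties
  using (↑ˡ-injective; ↑ʳ-injective; splitAt-↑ˡ; splitAt-↑ʳ; splitAt⁻¹-↑ˡ; splitAt⁻¹-↑ʳ; suc-injective)
  renaming (_≟_ to _≟ᶠ_)
open import Data.Product using (Σ; ∃; _×_; _,_; proj₁; proj₂)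
open import Data.Sum using (_⊎_; inj₁; inj₂)
open import Data.Empty using (⊥-elim)
open import Level using (0ℓ)
open import Relation.Nullary using (¬_; yes; no)
open import Relation.Binary.PropositionalEquality
open import Function.Bundles using (mk⇔; Equivalence)
open import Algebra.Bundles using (CommutativeRing)

module SymplecticGraph {q : ℕ} (𝔽 : FiniteField q) (ν : ℕ) where
  open FiniteField 𝔽 renaming (_+_ to infixl 6 _+_; _*_ to infixl 7 _*_; -_ to infix 8 -_)
  open Symplectic 𝔽 ν
  open Vertex
  open ≡-Reasoning

  ring : CommutativeRing 0ℓ 0ℓ
  ring = record { isCommutativeRing = isCommutativeRing }

  open CommutativeRing ring
    using (*-assoc; *-comm; distribˡ; distribʳ; zeroˡ; zeroʳ; +-identityˡ; +-identityʳ;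
           *-identityˡ; *-identityʳ; -‿inverseʳ)
  open import Algebra.Properties.Ring (CommutativeRing.ring ring)
    using (-‿distribˡ-*; -‿distribʳ-*; -‿injective; -0#≈0#; -‿+-comm; x∙y⁻¹≈ε⇒x≈y)
  open import Algebra.Properties.CommutativeSemigroup (CommutativeRing.+-commutativeSemigroup ring)
    using (interchange)
  open import Algebra.Properties.CommutativeSemigroup (CommutativeRing.*-commutativeSemigroup ring)
    using (x∙yz≈y∙xz)

  x*0+-y*0≡0 : ∀ x y → x * 0# + - (y * 0#) ≡ 0#
  x*0+-y*0≡0 x y = begin
    x * 0# + - (y * 0#) ≡⟨ cong₂ (λ s t → s + - t) (zeroʳ x) (zeroʳ y) ⟩
    0# + - 0#           ≡⟨ cong (0# +_) -0#≈0# ⟩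
    0# + 0#             ≡⟨ +-identityˡ 0# ⟩
    0#                  ∎

  Σ-cong : ∀ n {f g : Fin n → Carrier} → (∀ j → f j ≡ g j) → Σ[< n ] f ≡ Σ[< n ] g
  Σ-cong zero    f≗g = refl
  Σ-cong (suc n) f≗g = cong₂ _+_ (f≗g zero) (Σ-cong n (λ j → f≗g (suc j)))

  Σ-zero : ∀ n {f : Fin n → Carrier} → (∀ j → f j ≡ 0#) → Σ[< n ] f ≡ 0#
  Σ-zero zero    f≗0 = refl
  Σ-zero (suc n) f≗0 = trans (cong₂ _+_ (f≗0 zero) (Σ-zero n (λ j → f≗0 (suc j)))) (+-identityˡ 0#)

  Σ-distrib-+ : ∀ n (f g : Fin n → Carrier) → Σ[< n ] (λ j → f j + g j) ≡ Σ[< n ] f + Σ[< n ] g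
  Σ-distrib-+ zero    f g = sym (+-identityˡ 0#)
  Σ-distrib-+ (suc n) f g = trans (cong (f zero + g zero +_) (Σ-distrib-+ n _ _)) (interchange _ _ _ _)

  Σ-distribˡ-* : ∀ n c (f : Fin n → Carrier) → Σ[< n ] (λ j → c * f j) ≡ c * Σ[< n ] f
  Σ-distribˡ-* zero    c f = sym (zeroʳ c)
  Σ-distribˡ-* (suc n) c f = trans (cong (c * f zero +_) (Σ-distribˡ-* n c _)) (sym (distribˡ c _ _))

  Σ-single : ∀ n (i : Fin n) (f : Fin n → Carrier) → (∀ j → i ≢ j → f j ≡ 0#) → Σ[< n ] f ≡ f i
  Σ-single (suc n) zero    f f≗0 =
    trans (cong (f zero +_) (Σ-zero n (λ j → f≗0 (suc j) (λ ())))) (+-identityʳ _)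
  Σ-single (suc n) (suc i) f f≗0 =
    trans (cong₂ _+_ (f≗0 zero (λ ())) (Σ-single n i _ (λ j i≢j → f≗0 (suc j) (λ eq → i≢j (suc-injective eq)))))
          (+-identityˡ _)

  L R : Fin ν → Fin (ν Data.Nat.+ ν)
  L i = i ↑ˡ ν
  R i = ν ↑ʳ i

  L≢R : ∀ i j → L i ≢ R j
  L≢R i j eq with trans (sym (splitAt-↑ˡ ν i ν)) (trans (cong (splitAt ν) eq) (splitAt-↑ʳ ν ν j))
  ... | ()

  L-or-R : ∀ k → (∃ λ i → L i ≡ k) ⊎ (∃ λ i → R i ≡ k)
  L-or-R k with splitAt ν k in eq
  ... | inj₁ i = inj₁ (i , splitAt⁻¹-↑ˡ eq)
  ... | inj₂ i = inj₂ (i , splitAt⁻¹-↑ʳ eq)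

  ω-cong : ∀ {x x′ y y′} → x ≐ x′ → y ≐ y′ → ω x y ≡ ω x′ y′
  ω-cong x≐x′ y≐y′ = Σ-cong ν (λ i →
    cong₂ (λ a b → a + - b) (cong₂ _*_ (x≐x′ _) (y≐y′ _)) (cong₂ _*_ (x≐x′ _) (y≐y′ _)))

  ω-zeroʳ : ∀ x → ω x (λ _ → 0#) ≡ 0#
  ω-zeroʳ x = Σ-zero ν (λ i → x*0+-y*0≡0 _ _)

  ω-+ʳ : ∀ x y z → ω x (λ k → y k + z k) ≡ ω x y + ω x z
  ω-+ʳ x y z = trans (Σ-cong ν (λ i → term (x (L i)) (x (R i)) (y (R i)) (z (R i)) (y (L i)) (z (L i))))
                     (Σ-distrib-+ ν _ _)
    where
    term : ∀ a d b₁ c₁ b₂ c₂ →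
           a * (b₁ + c₁) + - (d * (b₂ + c₂)) ≡ (a * b₁ + - (d * b₂)) + (a * c₁ + - (d * c₂))
    term a d b₁ c₁ b₂ c₂ = begin
      a * (b₁ + c₁) + - (d * (b₂ + c₂))
        ≡⟨ cong₂ (λ s t → s + - t) (distribˡ a b₁ c₁) (distribˡ d b₂ c₂) ⟩
      a * b₁ + a * c₁ + - (d * b₂ + d * c₂)
        ≡⟨ cong (a * b₁ + a * c₁ +_) (sym (-‿+-comm (d * b₂) (d * c₂))) ⟩
      a * b₁ + a * c₁ + (- (d * b₂) + - (d * c₂))
        ≡⟨ interchange _ _ _ _ ⟩
      (a * b₁ + - (d * b₂)) + (a * c₁ + - (d * c₂))
        ∎

  ω-*ʳ : ∀ x c y → ω x (λ k → c * y k) ≡ c * ω x y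
  ω-*ʳ x c y = trans (Σ-cong ν (λ i → term (x (L i)) (x (R i)) (y (R i)) (y (L i)))) (Σ-distribˡ-* ν c _)
    where
    term : ∀ a d b e → a * (c * b) + - (d * (c * e)) ≡ c * (a * b + - (d * e))
    term a d b e = trans (cong₂ _+_ (x∙yz≈y∙xz a c b) (trans (cong -_ (x∙yz≈y∙xz d c e)) (-‿distribʳ-* c (d * e))))
                         (sym (distribˡ c _ _))

  ω-*ˡ : ∀ c x y → ω (λ k → c * x k) y ≡ c * ω x y
  ω-*ˡ c x y = trans (Σ-cong ν (λ i → term (x (L i)) (x (R i)) (y (R i)) (y (L i)))) (Σ-distribˡ-* ν c _)
    where
    term : ∀ a d b e → c * a * b + - (c * d * e) ≡ c * (a * b + - (d * e))
    term a d b e = trans (cong₂ _+_ (*-assoc c a b) (trans (cong -_ (*-assoc c d e)) (-‿distribʳ-* c (d * e))))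
                         (sym (distribˡ c _ _))

  ω-alternating : ∀ x → ω x x ≡ 0#
  ω-alternating x = Σ-zero ν (λ i →
    trans (cong (λ t → x (L i) * x (R i) + - t) (*-comm (x (R i)) (x (L i)))) (-‿inverseʳ _))

  basis : Fin (ν Data.Nat.+ ν) → Vec
  basis k j with k ≟ᶠ j
  ... | yes _ = 1#
  ... | no _  = 0#

  basis-diag : ∀ k → basis k k ≡ 1#
  basis-diag k with k ≟ᶠ k
  ... | yes _  = refl
  ... | no k≢k = ⊥-elim (k≢k refl)

  basis-offdiag : ∀ k j → k ≢ j → basis k j ≡ 0#
  basis-offdiag k j k≢j with k ≟ᶠ j
  ... | yes k≡j = ⊥-elim (k≢j k≡j)
  ... | no _    = refl

  ω-basisR : ∀ z i → ω z (basis (R i)) ≡ z (L i)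
  ω-basisR z i = trans (Σ-single ν i _ off) diag
    where
    off : ∀ j → i ≢ j → z (L j) * basis (R i) (R j) + - (z (R j) * basis (R i) (L j)) ≡ 0#
    off j i≢j = trans (cong₂ (λ s t → z (L j) * s + - (z (R j) * t))
                        (basis-offdiag _ _ (λ eq → i≢j (↑ʳ-injective ν i j eq)))
                        (basis-offdiag _ _ (λ eq → L≢R j i (sym eq))))
                      (x*0+-y*0≡0 _ _)
    diag : z (L i) * basis (R i) (R i) + - (z (R i) * basis (R i) (L i)) ≡ z (L i)
    diag = begin
      z (L i) * basis (R i) (R i) + - (z (R i) * basis (R i) (L i))
        ≡⟨ cong₂ (λ s t → z (L i) * s + - (z (R i) * t))
                 (basis-diag (R i)) (basis-offdiag _ _ (λ eq → L≢R i i (sym eq))) ⟩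
      z (L i) * 1# + - (z (R i) * 0#)   ≡⟨ cong₂ (λ s t → s + - t) (*-identityʳ _) (zeroʳ _) ⟩
      z (L i) + - 0#                    ≡⟨ cong (z (L i) +_) -0#≈0# ⟩
      z (L i) + 0#                      ≡⟨ +-identityʳ _ ⟩
      z (L i)                           ∎

  ω-basisL : ∀ z i → ω z (basis (L i)) ≡ - z (R i)
  ω-basisL z i = trans (Σ-single ν i _ off) diag
    where
    off : ∀ j → i ≢ j → z (L j) * basis (L i) (R j) + - (z (R j) * basis (L i) (L j)) ≡ 0#
    off j i≢j = trans (cong₂ (λ s t → z (L j) * s + - (z (R j) * t))
                        (basis-offdiag _ _ (L≢R i j))
                        (basis-offdiag _ _ (λ eq → i≢j (↑ˡ-injective ν i j eq))))
                      (x*0+-y*0≡0 _ _)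
    diag : z (L i) * basis (L i) (R i) + - (z (R i) * basis (L i) (L i)) ≡ - z (R i)
    diag = begin
      z (L i) * basis (L i) (R i) + - (z (R i) * basis (L i) (L i))
        ≡⟨ cong₂ (λ s t → z (L i) * s + - (z (R i) * t)) (basis-offdiag _ _ (L≢R i i)) (basis-diag (L i)) ⟩
      z (L i) * 0# + - (z (R i) * 1#)   ≡⟨ cong₂ (λ s t → s + - t) (zeroʳ _) (*-identityʳ _) ⟩
      0# + - z (R i)                    ≡⟨ +-identityˡ _ ⟩
      - z (R i)                         ∎

  ω-separates : ∀ {x y} → (∀ k → ω x (basis k) ≡ ω y (basis k)) → x ≐ y
  ω-separates {x} {y} same k with L-or-R k
  ... | inj₁ (i , refl) = trans (sym (ω-basisR x i)) (trans (same (R i)) (ω-basisR y i))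
  ... | inj₂ (i , refl) = -‿injective (trans (sym (ω-basisL x i)) (trans (same (L i)) (ω-basisL y i)))

  normalise : ∀ v y → ω v y ≢ 0# → Σ Vec λ u → ω v u ≡ 1#
  normalise v y ωvy≢0 with inverse (ω v y) ωvy≢0
  ... | d , p = (λ j → d * y j) , trans (ω-*ʳ v d y) (trans (*-comm d _) p)

  nondegenerate : ∀ v → NonZeroVec v → Σ Vec λ u → ω v u ≡ 1#
  nondegenerate v (k , vₖ≢0) with L-or-R k
  ... | inj₁ (i , refl) = normalise v (basis (R i)) (λ eq → vₖ≢0 (trans (sym (ω-basisR v i)) eq))
  ... | inj₂ (i , refl) =
    normalise v (basis (L i)) (λ eq → vₖ≢0 (-‿injective (trans (sym (ω-basisL v i)) (trans eq (sym -0#≈0#)))))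

  ⊥⊥⊆line : ∀ {v x} u → ω v u ≡ 1# → (∀ y → ω v y ≡ 0# → ω x y ≡ 0#) → x ≐ (λ i → ω x u * v i)
  ⊥⊥⊆line {v} {x} u ωvu≡1 x⊥v⊥ = ω-separates coordinate
    where
    c = ω x u
    coordinate : ∀ k → ω x (basis k) ≡ ω (λ i → c * v i) (basis k)
    coordinate k = begin
      ω x (basis k)            ≡⟨ x∙y⁻¹≈ε⇒x≈y _ _ x⊥y ⟩
      t * c                    ≡⟨ *-comm t c ⟩
      c * t                    ≡⟨ sym (ω-*ˡ c v (basis k)) ⟩
      ω (λ i → c * v i) (basis k) ∎
      where
      t = ω v (basis k)
      -- y is the projection of basis k onto v⊥ along u.
      y : Vec
      y j = basis k j + - t * u j
      ω-y : ∀ z → ω z y ≡ ω z (basis k) + - t * ω z u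
      ω-y z = trans (ω-+ʳ z (basis k) (λ j → - t * u j)) (cong (ω z (basis k) +_) (ω-*ʳ z (- t) u))
      y∈v⊥ : ω v y ≡ 0#
      y∈v⊥ = trans (ω-y v) (trans (cong (λ s → t + - t * s) ωvu≡1)
                             (trans (cong (t +_) (*-identityʳ (- t))) (-‿inverseʳ t)))
      x⊥y : ω x (basis k) + - (t * c) ≡ 0#
      x⊥y = trans (cong (ω x (basis k) +_) (-‿distribˡ-* t c)) (trans (sym (ω-y x)) (x⊥v⊥ y y∈v⊥))

  perp : (v : Vec) → NonZeroVec v → Vertex
  perp v v≢0 = record
    { sub = record
      { mem      = λ y → ω v y ≡ 0#
      ; mem-resp = λ y≐y′ p → trans (ω-cong {v} {v} (λ _ → refl) (λ i → sym (y≐y′ i))) p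
      ; zero∈    = ω-zeroʳ v
      ; +-closed = λ {y} {z} p r → trans (ω-+ʳ v y z) (trans (cong₂ _+_ p r) (+-identityˡ 0#))
      ; *-closed = λ c {y} p → trans (ω-*ʳ v c y) (trans (cong (c *_) p) (zeroʳ c))
      }
    ; nonzero = v , ω-alternating v , v≢0
    ; proper  = u , λ ωvu≡0 → 0≢1 (trans (sym ωvu≡0) ωvu≡1)
    }
    where
    u = proj₁ (nondegenerate v v≢0)
    ωvu≡1 = proj₂ (nondegenerate v v≢0)

  line : (w : Vec) → NonZeroVec w → Vertex
  line w w≢0 = record
    { sub = record
      { mem      = λ x → Σ Carrier λ c → x ≐ (λ i → c * w i)
      ; mem-resp = λ { x≐x′ (c , p) → c , λ i → trans (sym (x≐x′ i)) (p i) }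
      ; zero∈    = 0# , λ i → sym (zeroˡ (w i))
      ; +-closed = λ { (c , p) (d , r) → c + d , λ i → trans (cong₂ _+_ (p i) (r i)) (sym (distribʳ (w i) c d)) }
      ; *-closed = λ { a (c , p) → a * c , λ i → trans (cong (a *_) (p i)) (sym (*-assoc a c (w i))) }
      }
    ; nonzero = w , (1# , λ i → sym (*-identityˡ (w i))) , w≢0
    ; proper  = u , u∉line
    }
    where
    u = proj₁ (nondegenerate w w≢0)
    u∉line : ¬ Σ Carrier λ c → u ≐ (λ i → c * w i)
    u∉line (c , u≐cw) = 0≢1 (begin
      0#                     ≡⟨ sym (zeroʳ c) ⟩
      c * 0#                 ≡⟨ cong (c *_) (sym (ω-alternating w)) ⟩
      c * ω w w              ≡⟨ sym (ω-*ʳ w c w) ⟩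
      ω w (λ i → c * w i)    ≡⟨ sym (ω-cong {w} {w} (λ _ → refl) u≐cw) ⟩
      ω w u                  ≡⟨ proj₂ (nondegenerate w w≢0) ⟩
      1#                     ∎)

  generator∈ : ∀ (S : Subspace) {x v c} → Subspace.mem S x → NonZeroVec x → x ≐ (λ i → c * v i) →
               Subspace.mem S v
  generator∈ S {x} {v} {c} x∈S (k , xₖ≢0) x≐cv = Subspace.mem-resp S dx≐v (Subspace.*-closed S d x∈S)
    where
    c≢0 : c ≢ 0#
    c≢0 c≡0 = xₖ≢0 (trans (x≐cv k) (trans (cong (_* v k) c≡0) (zeroˡ (v k))))
    d = proj₁ (inverse c c≢0)
    dx≐v : (λ i → d * x i) ≐ v
    dx≐v i = begin
      d * x i       ≡⟨ cong (d *_) (x≐cv i) ⟩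
      d * (c * v i) ≡⟨ sym (*-assoc d c (v i)) ⟩
      d * c * v i   ≡⟨ cong (_* v i) (trans (*-comm d c) (proj₂ (inverse c c≢0))) ⟩
      1# * v i      ≡⟨ *-identityˡ (v i) ⟩
      v i           ∎

  _⊆_ : Vertex → Vertex → Set
  A ⊆ B = ∀ x → mem A x → mem B x

  _⊆ᴺ_ : Vertex → Vertex → Set₁
  A ⊆ᴺ B = ∀ C → Adjacent A C → Adjacent B C

  NbhdMaximal : Vertex → Set₁
  NbhdMaximal A = ∀ B → A ⊆ᴺ B → B ≈ A

  ≈-sym : ∀ A B → A ≈ B → B ≈ A
  ≈-sym A B A≈B x = proj₂ (A≈B x) , proj₁ (A≈B x)

  ≈-trans : ∀ A B C → A ≈ B → B ≈ C → A ≈ C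
  ≈-trans A B C A≈B B≈C x = (λ m → proj₁ (B≈C x) (proj₁ (A≈B x) m)) , (λ m → proj₂ (A≈B x) (proj₂ (B≈C x) m))

  ⊆⇒⊇ᴺ : ∀ A B → A ⊆ B → B ⊆ᴺ A
  ⊆⇒⊇ᴺ A B A⊆B C B~C x y x∈A y∈C = B~C x y (A⊆B x x∈A) y∈C

  ≈⇒⊆ᴺ : ∀ A B → A ≈ B → A ⊆ᴺ B
  ≈⇒⊆ᴺ A B A≈B = ⊆⇒⊇ᴺ B A (λ x → proj₂ (A≈B x))

  ⊆ᴺ-trans : ∀ A B C → A ⊆ᴺ B → B ⊆ᴺ C → A ⊆ᴺ C
  ⊆ᴺ-trans A B C A⊆ᴺB B⊆ᴺC D A~D = B⊆ᴺC D (A⊆ᴺB D A~D)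

  Adjacent-respʳ-≈ : ∀ X C D → C ≈ D → Adjacent X C → Adjacent X D
  Adjacent-respʳ-≈ X C D C≈D X~C x y x∈X y∈D = X~C x y x∈X (proj₂ (C≈D y) y∈D)

  NbhdMaximal-resp-≈ : ∀ A B → A ≈ B → NbhdMaximal A → NbhdMaximal B
  NbhdMaximal-resp-≈ A B A≈B maxA C B⊆ᴺC =
    ≈-trans C A B (maxA C (⊆ᴺ-trans A B C (≈⇒⊆ᴺ A B A≈B) B⊆ᴺC)) A≈B

  line⊆ : ∀ {w} w≢0 X → mem X w → line w w≢0 ⊆ X
  line⊆ w≢0 X w∈X x (c , x≐cw) = mem-resp X (λ i → sym (x≐cw i)) (*-closed X c w∈X)

  InM10⇒NbhdMaximal : ∀ A → InM10 A → NbhdMaximal A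
  InM10⇒NbhdMaximal A (v , v≢0 , A≡⟨v⟩) B A⊆ᴺB x = B⊆A x , A⊆B x
    where
    open Equivalence
    u = proj₁ (nondegenerate v v≢0)
    ωvu≡1 = proj₂ (nondegenerate v v≢0)
    A~v⊥ : Adjacent A (perp v v≢0)
    A~v⊥ x y x∈A y∈v⊥ with to (A≡⟨v⟩ x) x∈A
    ... | c , x≐cv = trans (ω-cong {x} {λ i → c * v i} {y} x≐cv (λ _ → refl))
                           (trans (ω-*ˡ c v y) (trans (cong (c *_) y∈v⊥) (zeroʳ c)))
    B⊆A : B ⊆ A
    B⊆A x x∈B = from (A≡⟨v⟩ x) (ω x u , ⊥⊥⊆line u ωvu≡1 (λ y → A⊆ᴺB (perp v v≢0) A~v⊥ x y x∈B))
    v∈B : mem B v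
    v∈B with nonzero B
    ... | w , w∈B , w≢0 = generator∈ (sub B) w∈B w≢0 (proj₂ (to (A≡⟨v⟩ w) (B⊆A w w∈B)))
    A⊆B : A ⊆ B
    A⊆B x x∈A with to (A≡⟨v⟩ x) x∈A
    ... | c , x≐cv = mem-resp B (λ i → sym (x≐cv i)) (*-closed B c v∈B)

  NbhdMaximal⇒InM10 : ∀ X → NbhdMaximal X → InM10 X
  NbhdMaximal⇒InM10 X maxX with nonzero X
  ... | w , w∈X , w≢0 = w , w≢0 , λ x → mk⇔ (proj₂ (⟨w⟩≈X x)) (proj₁ (⟨w⟩≈X x))
    where
    ⟨w⟩≈X : line w w≢0 ≈ X
    ⟨w⟩≈X = maxX (line w w≢0) (⊆⇒⊇ᴺ (line w w≢0) X (line⊆ w≢0 X w∈X))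

  module _ (aut : Automorphism) where
    open Automorphism aut
    open Equivalence

    σ-mono-⊆ᴺ : ∀ A B → A ⊆ᴺ B → σ A ⊆ᴺ σ B
    σ-mono-⊆ᴺ A B A⊆ᴺB C σA~C with σ-surjective C
    ... | C₀ , σC₀≈C = Adjacent-respʳ-≈ (σ B) (σ C₀) C σC₀≈C
      (to (σ-adj B C₀) (A⊆ᴺB C₀ (from (σ-adj A C₀) σA~σC₀)))
      where
      σA~σC₀ = Adjacent-respʳ-≈ (σ A) C (σ C₀) (≈-sym (σ C₀) C σC₀≈C) σA~C

    σ-reflects-⊆ᴺ : ∀ A B → σ A ⊆ᴺ σ B → A ⊆ᴺ B
    σ-reflects-⊆ᴺ A B σA⊆ᴺσB C A~C = from (σ-adj B C) (σA⊆ᴺσB (σ C) (to (σ-adj A C) A~C))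

    σ-preserves-NbhdMaximal : ∀ A → NbhdMaximal A → NbhdMaximal (σ A)
    σ-preserves-NbhdMaximal A maxA B σA⊆ᴺB with σ-surjective B
    ... | B₀ , σB₀≈B = ≈-trans B (σ B₀) (σ A) (≈-sym (σ B₀) B σB₀≈B) (σ-cong B₀≈A)
      where
      B₀≈A : B₀ ≈ A
      B₀≈A = maxA B₀ (σ-reflects-⊆ᴺ A B₀
               (⊆ᴺ-trans (σ A) B (σ B₀) σA⊆ᴺB (≈⇒⊆ᴺ B (σ B₀) (≈-sym (σ B₀) B σB₀≈B))))

    σ-reflects-NbhdMaximal : ∀ A → NbhdMaximal (σ A) → NbhdMaximal A
    σ-reflects-NbhdMaximal A maxσA B A⊆ᴺB = σ-injective (maxσA (σ B) (σ-mono-⊆ᴺ A B A⊆ᴺB))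

lemma3p1 : (q : ℕ) → IsPrimePower q → (𝔽 : FiniteField q) → (ν : ℕ) → 1 ≤ ν →
    (aut : Symplectic.Automorphism 𝔽 ν) →
    let open Symplectic 𝔽 ν
        open Automorphism aut
    in (∀ A → InM10 A → InM10 (σ A))
       × (∀ B → InM10 B → Σ Vertex (λ A → InM10 A × σ A ≈ B))
lemma3p1 q _ 𝔽 ν _ aut = preserves , hits
  where
  open Symplectic 𝔽 ν
  open Automorphism aut
  open SymplecticGraph 𝔽 ν

  preserves : ∀ A → InM10 A → InM10 (σ A)
  preserves A A∈M10 =
    NbhdMaximal⇒InM10 (σ A) (σ-preserves-NbhdMaximal aut A (InM10⇒NbhdMaximal A A∈M10))

  hits : ∀ B → InM10 B → Σ Vertex (λ A → InM10 A × σ A ≈ B)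
  hits B B∈M10 with σ-surjective B
  ... | A , σA≈B = A , A∈M10 , σA≈B
    where
    A∈M10 : InM10 A
    A∈M10 = NbhdMaximal⇒InM10 A (σ-reflects-NbhdMaximal aut A
              (NbhdMaximal-resp-≈ B (σ A) (≈-sym (σ A) B σA≈B) (InM10⇒NbhdMaximal B B∈M10)))
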